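{- There exists a lobster $T$ of diameter at most $5$ (indeed of diameter $4$) such that there is no $\alpha$-labeling of $T$ in which the central vertex is labeled by the critical number and an almost central vertex is labeled by the maximum label $|V(T)|-1$. For instance, one may take $T$ to be the tree on six vertices obtained from the path $a\,v_1\,v\,v_2\,b$ by attaching one additional leaf to $v_1$; its central vertex is $v$ and its almost central vertices are $v_1$ and $v_2$.
   Context: A graceful labeling of a tree $T$ on $n$ vertices is an injective map $f:V(T)\to\{0,1,\dots,n-1\}$ such that the edge weights $|f(u)-f(w)|$, over all edges $uw$, are exactly $\{1,\dots,n-1\}$. A labeling $f$ is bipartite if there is an integer $c$ such that for every edge $uw$, either $f(u)\le c<f(w)$ or $f(w)\le c<f(u)$; a graceful bipartite labeling is called an $\alpha$-labeling, and $c$ is its critical number. A lobster is a tree in which every vertex is at distance at most $2$ from some fixed longest path. The central vertex of a tree of even diameter is the unique vertex of minimum eccentricity. A vertex $w$ of a tree is an almost central vertex if $w$ is adjacent to a central vertex and lies on a longest path of the tree. -}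

module Defs where

open import Data.Nat using (ℕ; zero; suc; _≤_; _<_; _∸_; ∣_-_∣)
open import Data.Fin using (Fin)
open import Data.Product using (_×_; _,_; ∃; ∃-syntax; Σ-syntax)
open import Data.Sum using (_⊎_)
open import Data.List using (List; length)
open import Data.List.Membership.Propositional using (_∈_)
open import Data.List.Relation.Unary.Linked using (Linked)
open import Data.List.Relation.Unary.Unique.Propositional using (Unique)
open import Relation.Binary.PropositionalEquality using (_≡_; _≢_)
open import Relation.Nullary using (¬_)

EdgeList : ℕ → Set
EdgeList n = List (Fin n × Fin n)

module _ {n : ℕ} (E : EdgeList n) where

  Adj : Fin n → Fin n → Set
  Adj u w = ((u , w) ∈ E) ⊎ ((w , u) ∈ E)

  data Walk : Fin n → Fin n → ℕ → Set where
    here : ∀ {u} → Walk u u 0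
    step : ∀ {u x w k} → Adj u x → Walk x w k → Walk u w (suc k)

  Dist : Fin n → Fin n → ℕ → Set
  Dist u w d = Walk u w d × (∀ k → k < d → ¬ Walk u w k)

  Connected : Set
  Connected = ∀ u w → ∃[ k ] Walk u w k

  IsTree : Set
  IsTree = (1 ≤ n) × Connected × (length E ≡ n ∸ 1)

  HasDiameter : ℕ → Set
  HasDiameter d = (∃[ u ] ∃[ w ] Dist u w d) × (∀ u w k → Dist u w k → k ≤ d)

  Ecc : Fin n → ℕ → Set
  Ecc v e = (∃[ w ] Dist v w e) × (∀ w k → Dist v w k → k ≤ e)

  IsCentral : Fin n → Set
  IsCentral v = ∃[ e ] (Ecc v e × (∀ u e′ → u ≢ v → Ecc u e′ → e < e′))

  IsPath : List (Fin n) → Set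
  IsPath P = Linked Adj P × Unique P

  IsLongestPath : List (Fin n) → Set
  IsLongestPath P = IsPath P × (∀ Q → IsPath Q → length Q ≤ length P)

  IsLobster : Set
  IsLobster = ∃[ P ] (IsLongestPath P ×
                (∀ v → ∃[ x ] (x ∈ P × ∃[ k ] (k ≤ 2 × Walk v x k))))

  IsAlmostCentral : Fin n → Set
  IsAlmostCentral w = (∃[ v ] (IsCentral v × Adj v w))
                    × (∃[ P ] (IsLongestPath P × w ∈ P))

  IsGraceful : (Fin n → ℕ) → Set
  IsGraceful f = (∀ v → f v < n)
               × (∀ u w → f u ≡ f w → u ≡ w)
               × (∀ u w → (u , w) ∈ E → (1 ≤ ∣ f u - f w ∣ × ∣ f u - f w ∣ ≤ n ∸ 1))
               × (∀ k → 1 ≤ k → k ≤ n ∸ 1 → ∃[ u ] ∃[ w ] ((u , w) ∈ E × ∣ f u - f w ∣ ≡ k))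

  IsBipartiteLabeling : (Fin n → ℕ) → ℕ → Set
  IsBipartiteLabeling f c = ∀ u w → (u , w) ∈ E →
    ((f u ≤ c × c < f w) ⊎ (f w ≤ c × c < f u))

  IsAlphaLabeling : (Fin n → ℕ) → ℕ → Set
  IsAlphaLabeling f c = IsGraceful f × IsBipartiteLabeling f c

-- In an α-labelling with critical
-- number c = f(centre), the neighbours v₁, v₂ of the centre lie above c and the leaves a, b, a′
-- below it. Four distinct labels at most c force c ≥ 3, and with f(w) = 5 on one of v₁, v₂ the
-- other one gets 4, so c = 3 and the leaves carry 0, 1, 2. The edge weights then sum to
-- 3 f(v₁) + 2 f(v₂) − 2·3 − (0 + 1 + 2), which is 13 or 14, never 1 + ⋯ + 5 = 15: some weight
-- is missing.
module Submission where

open import Defs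
open import Data.Nat using (ℕ; _≤_; _∸_)
open import Data.Fin using (Fin)
open import Data.Product using (_×_; ∃-syntax)
open import Relation.Binary.PropositionalEquality using (_≡_)
open import Relation.Nullary using (¬_)

open import Data.Nat using (zero; suc; _+_; _<_; z≤n; s≤s; ∣_-_∣; _≟_)
open import Data.Nat.Properties
  using (≤ᵇ⇒≤; ≤-refl; ≤-reflexive; ≤-trans; ≤-pred; ≤-antisym; ≤∧≢⇒<; <⇒≱; ≤⇒≯; ≮⇒≥; +-mono-≤;
         ∣n-n∣≡0; ∣-∣-comm; ∣-∣-triangle)
open import Data.Fin using (zero; suc)
import Data.Fin as Fin
open import Data.Vec using (_∷_; []; lookup)
open import Data.Product using (_,_; proj₁; proj₂)
open import Data.Sum using (_⊎_; inj₁; inj₂; swap)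
open import Data.Unit using (⊤)
open import Data.Empty using (⊥; ⊥-elim)
open import Data.List using (List; []; _∷_; length; map; upTo; applyUpTo)
open import Data.List.Properties using (map-cong)
open import Data.List.Membership.Propositional using (_∈_)
open import Data.List.Membership.Propositional.Properties using (∈-map⁺; ∈-applyUpTo⁻; ∈-upTo⁺)
open import Data.List.Membership.DecPropositional _≟_ using (_∈?_)
open import Data.List.Relation.Unary.Any using (here; there)
open import Data.List.Relation.Unary.All using (All; all?; _∷_)
import Data.List.Relation.Unary.All as All
open import Data.List.Relation.Unary.Linked using ([-]; _∷_)
open import Data.List.Relation.Unary.AllPairs using (_∷_)
open import Data.List.Relation.Unary.Unique.DecPropositional (Fin._≟_ {6}) using (unique?)
open import Relation.Binary.PropositionalEquality using (refl; sym; trans; cong₂; subst; _≢_)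
open import Relation.Nullary using (Dec; yes; no; ¬?; contradiction)
open import Relation.Nullary.Decidable using (from-yes; _×-dec_; _→-dec_)

Lipschitz : ∀ {n} → EdgeList n → (Fin n → ℕ) → Set
Lipschitz E p = ∀ {u w} → (u , w) ∈ E → ∣ p u - p w ∣ ≤ 1

module _ {n : ℕ} {E : EdgeList n} where

  Adj-sym : ∀ {u w} → Adj E u w → Adj E w u
  Adj-sym = swap

  _++ʷ_ : ∀ {u x w k m} → Walk E u x k → Walk E x w m → Walk E u w (k + m)
  here       ++ʷ q = q
  step e p   ++ʷ q = step e (p ++ʷ q)

  snoc : ∀ {u x w k} → Walk E u x k → Adj E x w → Walk E u w (suc k)
  snoc here       e = step e here
  snoc (step d p) e = step d (snoc p e)

  reverse : ∀ {u w k} → Walk E u w k → Walk E w u k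
  reverse here       = here
  reverse (step e p) = snoc (reverse p) (Adj-sym e)

  dist≤length : ∀ {u w k m} → Dist E u w k → Walk E u w m → k ≤ m
  dist≤length {m = m} (_ , no-shorter) p = ≮⇒≥ λ m<k → no-shorter m m<k p

  module _ (p : Fin n → ℕ) (lipschitz : Lipschitz E p) where

    potential-gap≤length : ∀ {u w k} → Walk E u w k → ∣ p u - p w ∣ ≤ k
    potential-gap≤length {u} here = ≤-reflexive (∣n-n∣≡0 (p u))
    potential-gap≤length {u} {w} (step {x = x} e q) =
      ≤-trans (∣-∣-triangle (p u) (p x) (p w)) (+-mono-≤ (adjacent e) (potential-gap≤length q))
      where
      adjacent : Adj E u x → ∣ p u - p x ∣ ≤ 1
      adjacent (inj₁ ux) = lipschitz ux
      adjacent (inj₂ xu) = ≤-trans (≤-reflexive (∣-∣-comm (p u) (p x))) (lipschitz xu)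

    walk-of-potential-gap-is-shortest : ∀ {u w d} → Walk E u w d → ∣ p u - p w ∣ ≡ d → Dist E u w d
    walk-of-potential-gap-is-shortest q gap≡d =
      q , λ k k<d q′ → <⇒≱ k<d (≤-trans (≤-reflexive (sym gap≡d)) (potential-gap≤length q′))

module _ {n : ℕ} {E : EdgeList n} {f : Fin n → ℕ} {c : ℕ} (bipartite : IsBipartiteLabeling E f c) where

  straddles : ∀ {u w} → Adj E u w → (f u ≤ c × c < f w) ⊎ (f w ≤ c × c < f u)
  straddles (inj₁ uw) = bipartite _ _ uw
  straddles (inj₂ wu) = swap (bipartite _ _ wu)

  neighbour-above : ∀ {u w} → Adj E u w → f u ≤ c → c < f w
  neighbour-above uw fu≤c with straddles uw
  ... | inj₁ (_ , c<fw) = c<fw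
  ... | inj₂ (_ , c<fu) = contradiction fu≤c (<⇒≱ c<fu)

  neighbour-below : ∀ {u w} → Adj E u w → c < f u → f w ≤ c
  neighbour-below uw c<fu with straddles uw
  ... | inj₁ (fu≤c , _) = contradiction fu≤c (<⇒≱ c<fu)
  ... | inj₂ (fw≤c , _) = fw≤c

edgeWeights : ∀ {n} → (Fin n → ℕ) → EdgeList n → List ℕ
edgeWeights f = map λ (u , w) → ∣ f u - f w ∣

graceful⇒all-weights : ∀ {n} {E : EdgeList n} {f} → IsGraceful E f →
                       All (_∈ edgeWeights f E) (applyUpTo suc (n ∸ 1))
graceful⇒all-weights {f = f} (_ , _ , _ , attained) = All.tabulate λ k∈ →
  let i , i<n∸1 , k≡1+i = ∈-applyUpTo⁻ suc k∈
      u , w , uw∈E , weight≡1+i = attained (suc i) (s≤s z≤n) i<n∸1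
  in  subst (_∈ _) (trans weight≡1+i (sym k≡1+i)) (∈-map⁺ _ uw∈E)

three-distinct-below : ∀ {x y z c} → x < c → y < c → z < c → x ≢ y → x ≢ z → y ≢ z → 3 ≤ c
three-distinct-below {c = suc (suc (suc _))} _ _ _ _ _ _ = s≤s (s≤s (s≤s z≤n))
three-distinct-below {c = 1} (s≤s z≤n) (s≤s z≤n) _ x≢y _ _ = contradiction refl x≢y
three-distinct-below {0} {0} {c = 2} _ _ _ x≢y _ _ = contradiction refl x≢y
three-distinct-below {1} {1} {c = 2} _ _ _ x≢y _ _ = contradiction refl x≢y
three-distinct-below {0} {1} {0} {2} _ _ _ _ x≢z _ = contradiction refl x≢z
three-distinct-below {1} {0} {1} {2} _ _ _ _ x≢z _ = contradiction refl x≢z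
three-distinct-below {0} {1} {1} {2} _ _ _ _ _ y≢z = contradiction refl y≢z
three-distinct-below {1} {0} {0} {2} _ _ _ _ _ y≢z = contradiction refl y≢z
three-distinct-below {suc (suc _)} {c = 2} (s≤s (s≤s ())) _ _ _ _ _
three-distinct-below {y = suc (suc _)} {c = 2} _ (s≤s (s≤s ())) _ _ _ _
three-distinct-below {z = suc (suc _)} {c = 2} _ _ (s≤s (s≤s ())) _ _ _

3≤c<h<5⇒c≡3×h≡4 : ∀ {c h} → 3 ≤ c → c < h → h < 5 → c ≡ 3 × h ≡ 4
3≤c<h<5⇒c≡3×h≡4 3≤c c<h h<5 =
  ≤-antisym (≤-pred (≤-trans c<h (≤-pred h<5))) 3≤c ,
  ≤-antisym (≤-pred h<5) (≤-trans (s≤s 3≤c) c<h)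

V : Set
V = Fin 6

pattern a      = zero
pattern v₁     = suc zero
pattern centre = suc (suc zero)
pattern v₂     = suc (suc (suc zero))
pattern b      = suc (suc (suc (suc zero)))
pattern a′     = suc (suc (suc (suc (suc zero))))

T : EdgeList 6
T = (a , v₁) ∷ (v₁ , centre) ∷ (centre , v₂) ∷ (v₂ , b) ∷ (v₁ , a′) ∷ []

a~v₁ : Adj T a v₁
a~v₁ = inj₁ (here refl)

v₁~centre : Adj T v₁ centre
v₁~centre = inj₁ (there (here refl))

centre~v₂ : Adj T centre v₂
centre~v₂ = inj₁ (there (there (here refl)))

v₂~b : Adj T v₂ b
v₂~b = inj₁ (there (there (there (here refl))))

v₁~a′ : Adj T v₁ a′
v₁~a′ = inj₁ (there (there (there (there (here refl)))))

neighbours : V → List V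
neighbours a      = v₁ ∷ []
neighbours v₁     = a ∷ centre ∷ a′ ∷ []
neighbours centre = v₁ ∷ v₂ ∷ []
neighbours v₂     = centre ∷ b ∷ []
neighbours b      = v₂ ∷ []
neighbours a′     = v₁ ∷ []

Adj⇒neighbour : ∀ {u w} → Adj T u w → w ∈ neighbours u
Adj⇒neighbour (inj₁ (here refl))                                 = here refl
Adj⇒neighbour (inj₁ (there (here refl)))                         = there (here refl)
Adj⇒neighbour (inj₁ (there (there (here refl))))                 = there (here refl)
Adj⇒neighbour (inj₁ (there (there (there (here refl)))))         = there (here refl)
Adj⇒neighbour (inj₁ (there (there (there (there (here refl)))))) = there (there (here refl))
Adj⇒neighbour (inj₂ (here refl))                                 = here refl
Adj⇒neighbour (inj₂ (there (here refl)))                         = here refl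
Adj⇒neighbour (inj₂ (there (there (here refl))))                 = here refl
Adj⇒neighbour (inj₂ (there (there (there (here refl)))))         = here refl
Adj⇒neighbour (inj₂ (there (there (there (there (here refl)))))) = here refl

depth : V → ℕ
depth a      = 2
depth v₁     = 1
depth centre = 0
depth v₂     = 1
depth b      = 2
depth a′     = 2

depth≤2 : ∀ u → depth u ≤ 2
depth≤2 a      = ≤-refl
depth≤2 v₁     = s≤s z≤n
depth≤2 centre = z≤n
depth≤2 v₂     = s≤s z≤n
depth≤2 b      = ≤-refl
depth≤2 a′     = ≤-refl

fromCentre : ∀ u → Walk T centre u (depth u)
fromCentre a      = step (Adj-sym v₁~centre) (step (Adj-sym a~v₁) here)
fromCentre v₁     = step (Adj-sym v₁~centre) here
fromCentre centre = here
fromCentre v₂     = step centre~v₂ here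
fromCentre b      = step centre~v₂ (step v₂~b here)
fromCentre a′     = step (Adj-sym v₁~centre) (step v₁~a′ here)

viaCentre : ∀ u w → Walk T u w (depth u + depth w)
viaCentre u w = reverse (fromCentre u) ++ʷ fromCentre w

position : V → ℕ
position a      = 0
position v₁     = 1
position centre = 2
position v₂     = 3
position b      = 4
position a′     = 0

position-lipschitz : Lipschitz T position
position-lipschitz (here refl)                                 = ≤-refl
position-lipschitz (there (here refl))                         = ≤-refl
position-lipschitz (there (there (here refl)))                 = ≤-refl
position-lipschitz (there (there (there (here refl))))         = ≤-refl
position-lipschitz (there (there (there (there (here refl))))) = ≤-refl

dist-viaCentre : ∀ u w → ∣ position u - position w ∣ ≡ depth u + depth w →
                 Dist T u w (depth u + depth w)
dist-viaCentre u w = walk-of-potential-gap-is-shortest position position-lipschitz (viaCentre u w)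

T-isTree : IsTree T
T-isTree = s≤s z≤n , (λ u w → _ , viaCentre u w) , refl

T-diameter : HasDiameter T 4
T-diameter = (a , b , dist-viaCentre a b refl) ,
  λ u w k d → ≤-trans (dist≤length d (viaCentre u w)) (+-mono-≤ (depth≤2 u) (depth≤2 w))

centre-ecc : Ecc T centre 2
centre-ecc = (a , dist-viaCentre centre a refl) ,
  λ w k d → ≤-trans (dist≤length d (fromCentre w)) (depth≤2 w)

far-vertex : ∀ u → u ≢ centre → ∃[ w ] (2 ≤ depth u + depth w × Dist T u w (depth u + depth w))
far-vertex a      _ = b , s≤s (s≤s z≤n) , dist-viaCentre a b refl
far-vertex v₁     _ = b , s≤s (s≤s z≤n) , dist-viaCentre v₁ b refl
far-vertex centre u≢centre = contradiction refl u≢centre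
far-vertex v₂     _ = a , s≤s (s≤s z≤n) , dist-viaCentre v₂ a refl
far-vertex b      _ = a , s≤s (s≤s z≤n) , dist-viaCentre b a refl
far-vertex a′     _ = b , s≤s (s≤s z≤n) , dist-viaCentre a′ b refl

central⇒centre : ∀ {u} → IsCentral T u → u ≡ centre
central⇒centre {u} (e , (_ , within-e) , below-others) with u Fin.≟ centre
... | yes u≡centre = u≡centre
... | no  u≢centre =
  let w , 2≤k , dist = far-vertex u u≢centre
      e<2 = below-others centre 2 (λ centre≡u → u≢centre (sym centre≡u)) centre-ecc
  in  contradiction (≤-trans e<2 2≤k) (≤⇒≯ (within-e w _ dist))

Internal : V → Set
Internal v₁     = ⊤
Internal centre = ⊤
Internal v₂     = ⊤
Internal _      = ⊥

branching⇒internal : ∀ {u x y} → x ∈ neighbours u → y ∈ neighbours u → x ≢ y → Internal u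
branching⇒internal {a}      (here refl) (here refl) x≢y = contradiction refl x≢y
branching⇒internal {v₁}     _           _           _   = _
branching⇒internal {centre} _           _           _   = _
branching⇒internal {v₂}     _           _           _   = _
branching⇒internal {b}      (here refl) (here refl) x≢y = contradiction refl x≢y
branching⇒internal {a′}     (here refl) (here refl) x≢y = contradiction refl x≢y

internal-branching⇒centre : ∀ {u x y} → x ∈ neighbours u → y ∈ neighbours u → x ≢ y →
                            Internal x → Internal y → u ≡ centre
internal-branching⇒centre {centre} _ _ _ _ _ = refl
internal-branching⇒centre {a}  (here refl) (here refl) x≢y _ _ = contradiction refl x≢y
internal-branching⇒centre {b}  (here refl) (here refl) x≢y _ _ = contradiction refl x≢y
internal-branching⇒centre {a′} (here refl) (here refl) x≢y _ _ = contradiction refl x≢y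
internal-branching⇒centre {v₁} (there (here refl)) (there (here refl)) x≢y _ _ = contradiction refl x≢y
internal-branching⇒centre {v₁} (here refl)                 _ _ () _
internal-branching⇒centre {v₁} (there (there (here refl))) _ _ () _
internal-branching⇒centre {v₁} _ (here refl)                 _ _ ()
internal-branching⇒centre {v₁} _ (there (there (here refl))) _ _ ()
internal-branching⇒centre {v₂} (here refl) (here refl) x≢y _ _ = contradiction refl x≢y
internal-branching⇒centre {v₂} (there (here refl)) _ _ () _
internal-branching⇒centre {v₂} _ (there (here refl)) _ _ ()

-- The interior vertices x₂ … x₅ are internal, so both x₃ and x₄ would have to be the centre.
no-six-vertex-path : ∀ {x₁ x₂ x₃ x₄ x₅ x₆ xs} → ¬ IsPath T (x₁ ∷ x₂ ∷ x₃ ∷ x₄ ∷ x₅ ∷ x₆ ∷ xs)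
no-six-vertex-path
  (e₁ ∷ e₂ ∷ e₃ ∷ e₄ ∷ e₅ ∷ _ ,
   (_ ∷ x₁≢x₃ ∷ _) ∷ (_ ∷ x₂≢x₄ ∷ _) ∷ (x₃≢x₄ ∷ x₃≢x₅ ∷ _) ∷ (_ ∷ x₄≢x₆ ∷ _) ∷ _) =
  x₃≢x₄ (trans x₃≡centre (sym x₄≡centre))
  where
  back : ∀ {x y} → Adj T x y → x ∈ neighbours y
  back e = Adj⇒neighbour (Adj-sym e)
  x₂-int : Internal _
  x₂-int = branching⇒internal (back e₁) (Adj⇒neighbour e₂) x₁≢x₃
  x₃-int : Internal _
  x₃-int = branching⇒internal (back e₂) (Adj⇒neighbour e₃) x₂≢x₄
  x₄-int : Internal _
  x₄-int = branching⇒internal (back e₃) (Adj⇒neighbour e₄) x₃≢x₅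
  x₅-int : Internal _
  x₅-int = branching⇒internal (back e₄) (Adj⇒neighbour e₅) x₄≢x₆
  x₃≡centre : _ ≡ centre
  x₃≡centre = internal-branching⇒centre (back e₂) (Adj⇒neighbour e₃) x₂≢x₄ x₂-int x₄-int
  x₄≡centre : _ ≡ centre
  x₄≡centre = internal-branching⇒centre (back e₃) (Adj⇒neighbour e₄) x₃≢x₅ x₃-int x₅-int

spine : List V
spine = a ∷ v₁ ∷ centre ∷ v₂ ∷ b ∷ []

spine-isLongestPath : IsLongestPath T spine
spine-isLongestPath = (a~v₁ ∷ v₁~centre ∷ centre~v₂ ∷ v₂~b ∷ [-] , from-yes (unique? spine)) , at-most-five
  where
  at-most-five : ∀ Q → IsPath T Q → length Q ≤ 5
  at-most-five (_ ∷ _ ∷ _ ∷ _ ∷ _ ∷ _ ∷ _) path = ⊥-elim (no-six-vertex-path path)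
  at-most-five (_ ∷ _ ∷ _ ∷ _ ∷ _ ∷ [])    _    = ≤ᵇ⇒≤ _ _ _
  at-most-five (_ ∷ _ ∷ _ ∷ _ ∷ [])        _    = ≤ᵇ⇒≤ _ _ _
  at-most-five (_ ∷ _ ∷ _ ∷ [])            _    = ≤ᵇ⇒≤ _ _ _
  at-most-five (_ ∷ _ ∷ [])                _    = ≤ᵇ⇒≤ _ _ _
  at-most-five (_ ∷ [])                    _    = ≤ᵇ⇒≤ _ _ _
  at-most-five []                          _    = ≤ᵇ⇒≤ _ _ _

T-isLobster : IsLobster T
T-isLobster = spine , spine-isLongestPath , near-spine
  where
  near-spine : ∀ u → ∃[ x ] (x ∈ spine × ∃[ k ] (k ≤ 2 × Walk T u x k))
  near-spine a      = a , here refl , 0 , z≤n , here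
  near-spine v₁     = v₁ , there (here refl) , 0 , z≤n , here
  near-spine centre = centre , there (there (here refl)) , 0 , z≤n , here
  near-spine v₂     = v₂ , there (there (there (here refl))) , 0 , z≤n , here
  near-spine b      = b , there (there (there (there (here refl)))) , 0 , z≤n , here
  near-spine a′     = v₁ , there (here refl) , 1 , s≤s z≤n , step (Adj-sym v₁~a′) here

neighbours-of-centre : ∀ {w} → Adj T centre w → w ≡ v₁ ⊎ w ≡ v₂
neighbours-of-centre centre~w with Adj⇒neighbour centre~w
... | here refl         = inj₁ refl
... | there (here refl) = inj₂ refl

-- The vector lists the labels of a, v₁, centre, v₂, b, a′.
LeafLabellingsMissAWeight : ℕ → ℕ → Set
LeafLabellingsMissAWeight h₁ h₂ =
  All (λ x → All (λ y → All (λ z →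
        x ≢ y × x ≢ z × y ≢ z →
        ¬ All (_∈ edgeWeights (lookup (x ∷ h₁ ∷ 3 ∷ h₂ ∷ y ∷ z ∷ [])) T) (applyUpTo suc 5))
      (upTo 3)) (upTo 3)) (upTo 3)

leafLabellingsMissAWeight? : ∀ h₁ h₂ → Dec (LeafLabellingsMissAWeight h₁ h₂)
leafLabellingsMissAWeight? h₁ h₂ =
  all? (λ x → all? (λ y → all? (λ z →
         (¬? (x ≟ y) ×-dec ¬? (x ≟ z) ×-dec ¬? (y ≟ z)) →-dec ¬? (all? (_∈? _) (applyUpTo suc 5)))
       (upTo 3)) (upTo 3)) (upTo 3)

module CriticalCentre {f : V → ℕ} {c : ℕ} (α : IsAlphaLabeling T f c) (f-centre : f centre ≡ c) where

  graceful : IsGraceful T f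
  graceful = proj₁ α

  bipartite : IsBipartiteLabeling T f c
  bipartite = proj₂ α

  labels-distinct : ∀ {u w} → u ≢ w → f u ≢ f w
  labels-distinct u≢w fu≡fw = u≢w (proj₁ (proj₂ graceful) _ _ fu≡fw)

  centre-neighbour-above : ∀ {u} → Adj T centre u → c < f u
  centre-neighbour-above centre~u = neighbour-above bipartite centre~u (≤-reflexive f-centre)

  leaf-below : ∀ {u x} → Adj T centre u → Adj T u x → x ≢ centre → f x < c
  leaf-below centre~u u~x x≢centre =
    ≤∧≢⇒< (neighbour-below bipartite u~x (centre-neighbour-above centre~u))
          (λ fx≡c → labels-distinct x≢centre (trans fx≡c (sym f-centre)))

  a-below : f a < c
  a-below = leaf-below (Adj-sym v₁~centre) (Adj-sym a~v₁) (λ ())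

  b-below : f b < c
  b-below = leaf-below centre~v₂ v₂~b (λ ())

  a′-below : f a′ < c
  a′-below = leaf-below (Adj-sym v₁~centre) v₁~a′ (λ ())

  3≤c : 3 ≤ c
  3≤c = three-distinct-below a-below b-below a′-below
          (labels-distinct (λ ())) (labels-distinct (λ ())) (labels-distinct (λ ()))

  other-centre-neighbour-is-4 : ∀ {u w} → Adj T centre u → u ≢ w → f w ≡ 5 → c ≡ 3 × f u ≡ 4
  other-centre-neighbour-is-4 {u} centre~u u≢w fw≡5 =
    3≤c<h<5⇒c≡3×h≡4 3≤c (centre-neighbour-above centre~u)
      (≤∧≢⇒< (≤-pred (proj₁ graceful u)) (λ fu≡5 → labels-distinct u≢w (trans fu≡5 (sym fw≡5))))

  no-completion : ∀ {h₁ h₂} → f v₁ ≡ h₁ → f v₂ ≡ h₂ → c ≡ 3 → ¬ LeafLabellingsMissAWeight h₁ h₂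
  no-completion {h₁} {h₂} fv₁≡h₁ fv₂≡h₂ c≡3 miss =
    All.lookup (All.lookup (All.lookup miss (below-3 a-below)) (below-3 b-below)) (below-3 a′-below)
      (labels-distinct (λ ()) , labels-distinct (λ ()) , labels-distinct (λ ()))
      (subst (λ ws → All (_∈ ws) (applyUpTo suc 5)) weights≡ (graceful⇒all-weights graceful))
    where
    below-3 : ∀ {x} → x < c → x ∈ upTo 3
    below-3 x<c = ∈-upTo⁺ (subst (_ <_) c≡3 x<c)

    labelled : ∀ i → f i ≡ lookup (f a ∷ h₁ ∷ 3 ∷ h₂ ∷ f b ∷ f a′ ∷ []) i
    labelled a      = refl
    labelled v₁     = fv₁≡h₁
    labelled centre = trans f-centre c≡3
    labelled v₂     = fv₂≡h₂
    labelled b      = refl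
    labelled a′     = refl

    weights≡ : edgeWeights f T ≡ edgeWeights (lookup (f a ∷ h₁ ∷ 3 ∷ h₂ ∷ f b ∷ f a′ ∷ [])) T
    weights≡ = map-cong (λ (u , w) → cong₂ ∣_-_∣ (labelled u) (labelled w)) T

  no-max-at-centre-neighbour : ∀ {w} → Adj T centre w → f w ≢ 5
  no-max-at-centre-neighbour centre~w fw≡5 with neighbours-of-centre centre~w
  ... | inj₁ refl =
    let c≡3 , fv₂≡4 = other-centre-neighbour-is-4 centre~v₂ (λ ()) fw≡5
    in  no-completion fw≡5 fv₂≡4 c≡3 (from-yes (leafLabellingsMissAWeight? 5 4))
  ... | inj₂ refl =
    let c≡3 , fv₁≡4 = other-centre-neighbour-is-4 (Adj-sym v₁~centre) (λ ()) fw≡5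
    in  no-completion fv₁≡4 fw≡5 c≡3 (from-yes (leafLabellingsMissAWeight? 4 5))

no-α-labelling-with-critical-centre-and-max-almost-central :
  ∀ (f : V → ℕ) (c : ℕ) (v w : V) → IsAlphaLabeling T f c → IsCentral T v →
  IsAlmostCentral T w → f v ≡ c → f w ≢ 5
no-α-labelling-with-critical-centre-and-max-almost-central
  f c v w α v-central ((v′ , v′-central , v′~w) , _) fv≡c
  with refl ← central⇒centre v-central | refl ← central⇒centre v′-central =
  CriticalCentre.no-max-at-centre-neighbour α fv≡c v′~w

mainTheorem3 : ∃[ n ] ∃[ E ] (IsTree {n} E × IsLobster E × HasDiameter E 4 ×
    (∀ (f : Fin n → ℕ) (c : ℕ) (v w : Fin n) → IsAlphaLabeling E f c → IsCentral E v →
    IsAlmostCentral E w → f v ≡ c → ¬ (f w ≡ n ∸ 1)))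
mainTheorem3 = 6 , T , T-isTree , T-isLobster , T-diameter ,
  no-α-labelling-with-critical-centre-and-max-almost-central
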